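{- Let $\mathbf{A}$ belong to the variety $\mathsf{K}$. Then: (i) $\mathbf{A}$ has an involutive bisemilattice reduct $\langle A,\wedge,\vee,\neg,0,1\rangle$; (ii) the Płonka sum representation of this reduct has surjective homomorphisms $p_{ij}$; (iii) if the lowest fibre $\mathbf{A}_0$ in this Płonka representation is a $2$-element Boolean algebra, then there is a unique way to turn the involutive bisemilattice reduct of $\mathbf{A}$ into a $\mathsf{K}$-algebra, namely by defining, for every $a\in A$, $J_2a=1$ if $a=1_i$ for some $i\in I^+$, and $J_2a=0$ otherwise, where $I$ is the index semilattice, $1_i$ is the top element of fibre $\mathbf{A}_i$, and $I^+=\{i\in I: |A_i|>1\}$.
   Context: $\mathsf{K}$ is the variety of type $\langle\wedge,\vee,\neg,J_2,0,1\rangle$ axiomatised by: $x\vee x\approx x$; $x\vee y\approx y\vee x$; $x\vee(y\vee z)\approx(x\vee y)\vee z$; $\neg\neg x\approx x$; $x\wedge y\approx\neg(\neg x\vee\neg y)$; $x\wedge(\neg x\vee y)\approx x\wedge y$; $0\vee x\approx x$; $1\approx\neg0$; $J_2x\vee\neg J_2x\approx1$; $x\vee J_2y\approx x\vee J_2(x\vee y)$; $x\wedge J_2x\approx x$; $J_2(x\wedge\neg x)\approx0$. An involutive bisemilattice is an algebra $\langle A,\wedge,\vee,\neg,0,1\rangle$ satisfying the first eight of these identities; every involutive bisemilattice is (up to isomorphism) the Płonka sum of a semilattice direct system of Boolean algebras $\{\mathbf{A}_i\}_{i\in I}$ over a lower-bounded join-semilattice $\langle I,\vee,0\rangle$ with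 homomorphisms $p_{ij}:\mathbf{A}_i\to\mathbf{A}_j$ ($i\le j$) satisfying $p_{ii}=\mathrm{id}$, $p_{jk}p_{ij}=p_{ik}$; in the Płonka sum operations on elements from fibres $A_{i_1},\dots,A_{i_n}$ are computed in $\mathbf{A}_{i_1\vee\dots\vee i_n}$ after applying the $p$'s, and constants lie in the lowest fibre $\mathbf{A}_0$. -}

module Defs where

open import Level using (0ℓ)
open import Data.Product using (Σ; ∃; ∃-syntax; _×_; _,_; proj₁; proj₂)
open import Data.Sum using (_⊎_)
open import Relation.Nullary using (¬_)
open import Relation.Binary.PropositionalEquality
  using (_≡_; _≢_; refl; sym; trans; cong)
open import Algebra.Lattice.Structures using (IsSemilattice; IsBooleanAlgebra)

record IsInvolutiveBisemilattice (A : Set)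
    (_∧_ _∨_ : A → A → A) (¬′ : A → A) (𝟘 𝟙 : A) : Set where
  field
    ∨-idem    : ∀ x → x ∨ x ≡ x
    ∨-comm    : ∀ x y → x ∨ y ≡ y ∨ x
    ∨-assoc   : ∀ x y z → x ∨ (y ∨ z) ≡ (x ∨ y) ∨ z
    ¬¬        : ∀ x → ¬′ (¬′ x) ≡ x
    ∧-def     : ∀ x y → x ∧ y ≡ ¬′ (¬′ x ∨ ¬′ y)
    ∧-¬∨      : ∀ x y → x ∧ (¬′ x ∨ y) ≡ x ∧ y
    0-∨       : ∀ x → 𝟘 ∨ x ≡ x
    1-def     : 𝟙 ≡ ¬′ 𝟘

record IsK (A : Set)
    (_∧_ _∨_ : A → A → A) (¬′ : A → A) (J₂ : A → A) (𝟘 𝟙 : A) : Set where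
  field
    isInvolutiveBisemilattice : IsInvolutiveBisemilattice A _∧_ _∨_ ¬′ 𝟘 𝟙
    J-excluded : ∀ y → J₂ y ∨ ¬′ (J₂ y) ≡ 𝟙
    J-∨        : ∀ x y → x ∨ J₂ y ≡ x ∨ J₂ (x ∨ y)
    J-∧        : ∀ x → x ∧ J₂ x ≡ x
    J-contr    : ∀ x → J₂ (x ∧ ¬′ x) ≡ 𝟘

record KAlgebra : Set₁ where
  field
    Carrier : Set
    _∧_ _∨_ : Carrier → Carrier → Carrier
    ¬′      : Carrier → Carrier
    J₂      : Carrier → Carrier
    𝟘 𝟙     : Carrier
    isK     : IsK Carrier _∧_ _∨_ ¬′ J₂ 𝟘 𝟙

record InvolutiveBisemilattice : Set₁ where
  field
    Carrier : Set
    _∧_ _∨_ : Carrier → Carrier → Carrier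
    ¬′      : Carrier → Carrier
    𝟘 𝟙     : Carrier
    isInvolutiveBisemilattice : IsInvolutiveBisemilattice Carrier _∧_ _∨_ ¬′ 𝟘 𝟙

reduct : KAlgebra → InvolutiveBisemilattice
reduct A = record
  { Carrier = Carrier ; _∧_ = _∧_ ; _∨_ = _∨_ ; ¬′ = ¬′ ; 𝟘 = 𝟘 ; 𝟙 = 𝟙
  ; isInvolutiveBisemilattice = IsK.isInvolutiveBisemilattice isK }
  where open KAlgebra A

record SemilatticeDirectSystem : Set₁ where
  field
    I        : Set
    _⊔_      : I → I → I
    i₀       : I
    isSemilattice : IsSemilattice _≡_ _⊔_
    i₀-least : ∀ i → i₀ ⊔ i ≡ i

  _≤_ : I → I → Set
  i ≤ j = i ⊔ j ≡ j

  field
    Fib   : I → Set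
    join  : ∀ i → Fib i → Fib i → Fib i
    meet  : ∀ i → Fib i → Fib i → Fib i
    neg   : ∀ i → Fib i → Fib i
    top   : ∀ i → Fib i
    bot   : ∀ i → Fib i
    isBooleanAlgebra : ∀ i →
      IsBooleanAlgebra _≡_ (join i) (meet i) (neg i) (top i) (bot i)
    p     : ∀ i j → i ≤ j → Fib i → Fib j
    p-∨   : ∀ i j (q : i ≤ j) x y → p i j q (join i x y) ≡ join j (p i j q x) (p i j q y)
    p-∧   : ∀ i j (q : i ≤ j) x y → p i j q (meet i x y) ≡ meet j (p i j q x) (p i j q y)
    p-¬   : ∀ i j (q : i ≤ j) x → p i j q (neg i x) ≡ neg j (p i j q x)
    p-top : ∀ i j (q : i ≤ j) → p i j q (top i) ≡ top j
    p-bot : ∀ i j (q : i ≤ j) → p i j q (bot i) ≡ bot j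
    p-id   : ∀ i (q : i ≤ i) x → p i i q x ≡ x
    p-comp : ∀ i j k (q₁ : i ≤ j) (q₂ : j ≤ k) (q₃ : i ≤ k) x →
      p j k q₂ (p i j q₁ x) ≡ p i k q₃ x

  open IsSemilattice _≡_ isSemilattice using (assoc; idem; comm)

  ≤-⊔ˡ : ∀ i j → i ≤ (i ⊔ j)
  ≤-⊔ˡ i j = trans (sym (assoc i i j)) (cong (_⊔ j) (idem i))

  ≤-⊔ʳ : ∀ i j → j ≤ (i ⊔ j)
  ≤-⊔ʳ i j = trans (cong (j ⊔_) (comm i j)) (trans (≤-⊔ˡ j i) (comm j i))

  Sum : Set
  Sum = Σ I Fib

  _∨ₛ_ : Sum → Sum → Sum
  (i , a) ∨ₛ (j , b) =
    i ⊔ j , join (i ⊔ j) (p i (i ⊔ j) (≤-⊔ˡ i j) a) (p j (i ⊔ j) (≤-⊔ʳ i j) b)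

  _∧ₛ_ : Sum → Sum → Sum
  (i , a) ∧ₛ (j , b) =
    i ⊔ j , meet (i ⊔ j) (p i (i ⊔ j) (≤-⊔ˡ i j) a) (p j (i ⊔ j) (≤-⊔ʳ i j) b)

  ¬ₛ : Sum → Sum
  ¬ₛ (i , a) = i , neg i a

  0ₛ : Sum
  0ₛ = i₀ , bot i₀

  1ₛ : Sum
  1ₛ = i₀ , top i₀

  InI⁺ : I → Set
  InI⁺ i = Σ (Fib i) λ x → Σ (Fib i) λ y → ¬ (x ≡ y)

  TwoElement : I → Set
  TwoElement i = Σ (Fib i) λ a → Σ (Fib i) λ b → ¬ (a ≡ b) × (∀ x → x ≡ a ⊎ x ≡ b)

record PlonkaRepresentation (A : InvolutiveBisemilattice) : Set₁ where
  open InvolutiveBisemilattice A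
  field
    system : SemilatticeDirectSystem
  open SemilatticeDirectSystem system public
  field
    φ     : Carrier → Sum
    ψ     : Sum → Carrier
    ψφ    : ∀ a → ψ (φ a) ≡ a
    φψ    : ∀ s → φ (ψ s) ≡ s
    φ-∨   : ∀ a b → φ (a ∨ b) ≡ φ a ∨ₛ φ b
    φ-∧   : ∀ a b → φ (a ∧ b) ≡ φ a ∧ₛ φ b
    φ-¬   : ∀ a → φ (¬′ a) ≡ ¬ₛ (φ a)
    φ-0   : φ 𝟘 ≡ 0ₛ
    φ-1   : φ 𝟙 ≡ 1ₛ

  -- The prescribed operation: J₂ a = 1 if a = 1_i for some i ∈ I⁺, else 0
  -- (stated as a relation, to avoid assuming decidability).
  IsTopOfNontrivialFibre : Carrier → Set
  IsTopOfNontrivialFibre a = ∃[ i ] (InI⁺ i × φ a ≡ (i , top i))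

  IsPrescribedJ : (Carrier → Carrier) → Set
  IsPrescribedJ J = ∀ a →
    (IsTopOfNontrivialFibre a → J a ≡ 𝟙) × (¬ IsTopOfNontrivialFibre a → J a ≡ 𝟘)

-- Since J₂ x ∨ ¬J₂ x = 1, every J₂ x lies in the lowest fibre A₀; since x ∧ J₂ x = x and
-- x ∨ J₂ x = x, pushing J₂ x from A₀ into the fibre of x gives back x itself. Hence every
-- p₀ⱼ is onto, and so is every pᵢⱼ, through which p₀ⱼ factors. When A₀ = {0, 1}, J₂ x is 0 or 1
-- and x is correspondingly the bottom or the top of its fibre; the top of a trivial fibre
-- satisfies x ∧ ¬x = x, so J₂ x = J₂ (x ∧ ¬x) = 0 there. This pins J₂ down pointwise.
module Submission where

open import Defs
open import Data.Product using (Σ; ∃-syntax; _×_; _,_; proj₁; proj₂)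
open import Data.Sum using (_⊎_; inj₁; inj₂)
open import Relation.Nullary using (¬_; contradiction)
open import Relation.Binary.PropositionalEquality
  using (_≡_; _≢_; refl; sym; trans; cong; cong₂; module ≡-Reasoning)
open import Algebra.Lattice.Bundles using (Lattice; BooleanAlgebra)
import Algebra.Lattice.Properties.BooleanAlgebra as BooleanAlgebraProperties
import Algebra.Lattice.Structures as LatticeStructures
import Relation.Binary.Reasoning.Setoid as SetoidReasoning

module _ {c ℓ} (L : Lattice c ℓ) where
  open Lattice L
  open SetoidReasoning setoid

  ∨-∧-absorbed⇒≈ : ∀ {x y} → x ∨ y ≈ x → x ∧ y ≈ x → y ≈ x
  ∨-∧-absorbed⇒≈ {x} {y} x∨y≈x x∧y≈x = begin
    y            ≈⟨ ∧-absorbs-∨ y x ⟨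
    y ∧ (y ∨ x)  ≈⟨ ∧-congˡ (∨-comm y x) ⟩
    y ∧ (x ∨ y)  ≈⟨ ∧-congˡ x∨y≈x ⟩
    y ∧ x        ≈⟨ ∧-comm y x ⟩
    x ∧ y        ≈⟨ x∧y≈x ⟩
    x            ∎

module _ {c ℓ} (B : BooleanAlgebra c ℓ) where
  open BooleanAlgebra B
  open BooleanAlgebraProperties B using (∧-identityʳ; ∧-zeroʳ)
  open SetoidReasoning setoid

  ⊤≈⊥⇒≈⊥ : ⊤ ≈ ⊥ → ∀ x → x ≈ ⊥
  ⊤≈⊥⇒≈⊥ ⊤≈⊥ x = begin
    x      ≈⟨ ∧-identityʳ x ⟨
    x ∧ ⊤  ≈⟨ ∧-congˡ ⊤≈⊥ ⟩
    x ∧ ⊥  ≈⟨ ∧-zeroʳ x ⟩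
    ⊥      ∎

module IsInvolutiveBisemilatticeProperties
    {A : Set} {_∧_ _∨_ : A → A → A} {¬′ : A → A} {𝟘 𝟙 : A}
    (IB : IsInvolutiveBisemilattice A _∧_ _∨_ ¬′ 𝟘 𝟙) where
  open IsInvolutiveBisemilattice IB
  open ≡-Reasoning

  ∨-0 : ∀ x → x ∨ 𝟘 ≡ x
  ∨-0 x = trans (∨-comm x 𝟘) (0-∨ x)

  0∧¬0 : 𝟘 ∧ ¬′ 𝟘 ≡ 𝟘
  0∧¬0 = begin
    𝟘 ∧ ¬′ 𝟘                ≡⟨ ∧-def 𝟘 (¬′ 𝟘) ⟩
    ¬′ (¬′ 𝟘 ∨ ¬′ (¬′ 𝟘))   ≡⟨ cong (λ z → ¬′ (¬′ 𝟘 ∨ z)) (¬¬ 𝟘) ⟩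
    ¬′ (¬′ 𝟘 ∨ 𝟘)           ≡⟨ cong ¬′ (∨-0 (¬′ 𝟘)) ⟩
    ¬′ (¬′ 𝟘)               ≡⟨ ¬¬ 𝟘 ⟩
    𝟘                       ∎

module IsKProperties
    {A : Set} {_∧_ _∨_ : A → A → A} {¬′ J : A → A} {𝟘 𝟙 : A}
    (K : IsK A _∧_ _∨_ ¬′ J 𝟘 𝟙) where
  open IsK K
  open IsInvolutiveBisemilatticeProperties isInvolutiveBisemilattice
  open ≡-Reasoning

  J-0 : J 𝟘 ≡ 𝟘
  J-0 = trans (cong J (sym 0∧¬0)) (J-contr 𝟘)

  ∨-J : ∀ x → x ∨ J x ≡ x
  ∨-J x = begin
    x ∨ J x          ≡⟨ cong (λ z → x ∨ J z) (∨-0 x) ⟨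
    x ∨ J (x ∨ 𝟘)    ≡⟨ J-∨ x 𝟘 ⟨
    x ∨ J 𝟘          ≡⟨ cong (x ∨_) J-0 ⟩
    x ∨ 𝟘            ≡⟨ ∨-0 x ⟩
    x                ∎

IsK-cong : ∀ {A : Set} {_∧_ _∨_ : A → A → A} {¬′ J J′ : A → A} {𝟘 𝟙 : A} →
  (∀ x → J x ≡ J′ x) → IsK A _∧_ _∨_ ¬′ J 𝟘 𝟙 → IsK A _∧_ _∨_ ¬′ J′ 𝟘 𝟙
IsK-cong {_∧_ = _∧_} {_∨_} {¬′} {J} {J′} J≗J′ K = record
  { isInvolutiveBisemilattice = isInvolutiveBisemilattice
  ; J-excluded = λ y → trans (cong (λ z → z ∨ ¬′ z) (sym (J≗J′ y))) (J-excluded y)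
  ; J-∨        = λ x y → trans (cong (x ∨_) (sym (J≗J′ y)))
                           (trans (J-∨ x y) (cong (x ∨_) (J≗J′ (x ∨ y))))
  ; J-∧        = λ x → trans (cong (x ∧_) (sym (J≗J′ x))) (J-∧ x)
  ; J-contr    = λ x → trans (sym (J≗J′ _)) (J-contr x)
  }
  where open IsK K

module SemilatticeDirectSystemProperties (S : SemilatticeDirectSystem) where
  open SemilatticeDirectSystem S
  open LatticeStructures.IsSemilattice _≡_ isSemilattice using (idem; comm)
  open ≡-Reasoning

  fibre : I → BooleanAlgebra _ _
  fibre i = record { isBooleanAlgebra = isBooleanAlgebra i }

  ≤-reflexive : ∀ {i j} → i ≡ j → i ≤ j
  ≤-reflexive {j = j} i≡j = trans (cong (_⊔ j) i≡j) (idem j)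

  ≤-refl : ∀ i → i ≤ i
  ≤-refl = idem

  ∈-fibre : ∀ {i} (s : Sum) → proj₁ s ≡ i → Σ (Fib i) λ c → s ≡ (i , c)
  ∈-fibre (i , c) refl = c , refl

  p-≡ : ∀ {i j} {a : Fib i} {b : Fib j} → _≡_ {A = Sum} (i , a) (j , b) →
    (q : i ≤ j) → p i j q a ≡ b
  p-≡ refl q = p-id _ q _

  ≡-via-p : ∀ {i j} {a : Fib i} {b : Fib j} → i ≡ j → (q : i ≤ j) →
    p i j q a ≡ b → _≡_ {A = Sum} (i , a) (j , b)
  ≡-via-p {j = j} {a} refl q pa≡b = cong (j ,_) (trans (sym (p-id j q a)) pa≡b)

  ,-injectiveʳ : ∀ {i} {a b : Fib i} → _≡_ {A = Sum} (i , a) (i , b) → a ≡ b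
  ,-injectiveʳ {i} {a} e = trans (sym (p-id i (≤-refl i) a)) (p-≡ e (≤-refl i))

  -- _∨ₛ_ and _∧ₛ_ are definitionally lift join and lift meet.
  lift : (∀ k → Fib k → Fib k → Fib k) → Sum → Sum → Sum
  lift op (i , a) (j , b) =
    i ⊔ j , op (i ⊔ j) (p i (i ⊔ j) (≤-⊔ˡ i j) a) (p j (i ⊔ j) (≤-⊔ʳ i j) b)

  lift-absorbed : (op : ∀ k → Fib k → Fib k → Fib k) →
    (∀ i j (q : i ≤ j) x y → p i j q (op i x y) ≡ op j (p i j q x) (p i j q y)) →
    ∀ {i j} (q : i ≤ j) {y : Fib j} {c : Fib i} →
    lift op (j , y) (i , c) ≡ (j , y) → op j y (p i j q c) ≡ y
  lift-absorbed op p-op {i} {j} q {y} {c} absorbed = begin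
    op j y (p i j q c)
      ≡⟨ cong₂ (op j) (sym (trans (p-comp j k j l r (≤-refl j) y) (p-id j (≤-refl j) y)))
                      (sym (p-comp i k j l′ r q c)) ⟩
    op j (p k j r (p j k l y)) (p k j r (p i k l′ c))
      ≡⟨ p-op k j r _ _ ⟨
    p k j r (op k (p j k l y) (p i k l′ c))
      ≡⟨ p-≡ absorbed r ⟩
    y ∎
    where
    k = j ⊔ i
    l = ≤-⊔ˡ j i
    l′ = ≤-⊔ʳ j i
    r = ≤-reflexive (trans (comm j i) q)

  p-surjective-from-i₀ :
    (∀ j (y : Fib j) → ∃[ c ] p i₀ j (i₀-least j) c ≡ y) →
    ∀ i j (q : i ≤ j) (y : Fib j) → ∃[ x ] p i j q x ≡ y
  p-surjective-from-i₀ onto i j q y with onto j y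
  ... | c , pc≡y = p i₀ i (i₀-least i) c , trans (p-comp i₀ i j _ q _ c) pc≡y

  InI⁺⇒top≢bot : ∀ {i} → InI⁺ i → top i ≢ bot i
  InI⁺⇒top≢bot {i} (x , y , x≢y) top≡bot =
    x≢y (trans (⊤≈⊥⇒≈⊥ (fibre i) top≡bot x) (sym (⊤≈⊥⇒≈⊥ (fibre i) top≡bot y)))

  TwoElement⇒top≢bot : ∀ {i} → TwoElement i → top i ≢ bot i
  TwoElement⇒top≢bot (a , b , a≢b , _) = InI⁺⇒top≢bot (a , b , a≢b)

  TwoElement⇒top⊎bot : ∀ {i} → TwoElement i → ∀ x → x ≡ top i ⊎ x ≡ bot i
  TwoElement⇒top⊎bot {i} two@(a , b , _ , cover) x
    with cover (top i) | cover (bot i) | cover x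
  ... | inj₁ ⊤≡a | inj₁ ⊥≡a | _        = contradiction (trans ⊤≡a (sym ⊥≡a)) (TwoElement⇒top≢bot two)
  ... | inj₂ ⊤≡b | inj₂ ⊥≡b | _        = contradiction (trans ⊤≡b (sym ⊥≡b)) (TwoElement⇒top≢bot two)
  ... | inj₁ ⊤≡a | inj₂ ⊥≡b | inj₁ x≡a = inj₁ (trans x≡a (sym ⊤≡a))
  ... | inj₁ ⊤≡a | inj₂ ⊥≡b | inj₂ x≡b = inj₂ (trans x≡b (sym ⊥≡b))
  ... | inj₂ ⊤≡b | inj₁ ⊥≡a | inj₁ x≡a = inj₂ (trans x≡a (sym ⊥≡a))
  ... | inj₂ ⊤≡b | inj₁ ⊥≡a | inj₂ x≡b = inj₁ (trans x≡b (sym ⊤≡b))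

module PlonkaRepresentationProperties
    {B : InvolutiveBisemilattice} (R : PlonkaRepresentation B) where
  open InvolutiveBisemilattice B
  open PlonkaRepresentation R
  open SemilatticeDirectSystemProperties system
  open LatticeStructures.IsSemilattice _≡_ isSemilattice using (idem)

  φ-injective : ∀ {a b} → φ a ≡ φ b → a ≡ b
  φ-injective {a} {b} φa≡φb = trans (sym (ψφ a)) (trans (cong ψ φa≡φb) (ψφ b))

  𝟙≢𝟘 : top i₀ ≢ bot i₀ → 𝟙 ≢ 𝟘
  𝟙≢𝟘 top≢bot 𝟙≡𝟘 =
    top≢bot (,-injectiveʳ (trans (sym φ-1) (trans (cong φ 𝟙≡𝟘) φ-0)))

  excluded-middle⇒∈-i₀ : ∀ x → x ∨ ¬′ x ≡ 𝟙 → Σ (Fib i₀) λ c → φ x ≡ (i₀ , c)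
  excluded-middle⇒∈-i₀ x x∨¬x≡𝟙 = ∈-fibre (φ x) (begin
    proj₁ (φ x)                   ≡⟨ idem _ ⟨
    proj₁ (φ x ∨ₛ ¬ₛ (φ x))       ≡⟨ cong proj₁ (trans (φ-∨ x (¬′ x)) (cong (φ x ∨ₛ_) (φ-¬ x))) ⟨
    proj₁ (φ (x ∨ ¬′ x))          ≡⟨ cong (λ z → proj₁ (φ z)) x∨¬x≡𝟙 ⟩
    proj₁ (φ 𝟙)                   ≡⟨ cong proj₁ φ-1 ⟩
    i₀                            ∎)
    where open ≡-Reasoning

  trivial-fibre⇒∧¬-fixed : ∀ {a j y} → φ a ≡ (j , y) → top j ≡ bot j → a ∧ ¬′ a ≡ a
  trivial-fibre⇒∧¬-fixed {a} {j} {y} φa≡jy top≡bot = φ-injective (begin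
    φ (a ∧ ¬′ a)               ≡⟨ trans (φ-∧ a (¬′ a)) (cong (φ a ∧ₛ_) (φ-¬ a)) ⟩
    φ a ∧ₛ ¬ₛ (φ a)            ≡⟨ cong (λ s → s ∧ₛ ¬ₛ s) φa≡jy ⟩
    (j , y) ∧ₛ (j , neg j y)   ≡⟨ ≡-via-p (idem j) (≤-reflexive (idem j)) all-equal ⟩
    (j , y)                    ≡⟨ φa≡jy ⟨
    φ a                        ∎)
    where
    open ≡-Reasoning
    all-equal : ∀ {u v : Fib j} → u ≡ v
    all-equal = trans (⊤≈⊥⇒≈⊥ (fibre j) top≡bot _) (sym (⊤≈⊥⇒≈⊥ (fibre j) top≡bot _))

  module _ {J : Carrier → Carrier} (K : IsK Carrier _∧_ _∨_ ¬′ J 𝟘 𝟙) where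
    open IsK K using (J-excluded; J-∧; J-contr)
    open IsKProperties K using (∨-J)
    open ≡-Reasoning

    J-∈-i₀ : ∀ a → Σ (Fib i₀) λ c → φ (J a) ≡ (i₀ , c)
    J-∈-i₀ a = excluded-middle⇒∈-i₀ (J a) (J-excluded a)

    J-lifts : ∀ {a j y c} → φ a ≡ (j , y) → φ (J a) ≡ (i₀ , c) →
      p i₀ j (i₀-least j) c ≡ y
    J-lifts {a} {j} {y} {c} φa≡jy φJa≡c = ∨-∧-absorbed⇒≈ (BooleanAlgebra.lattice (fibre j))
        (lift-absorbed join p-∨ (i₀-least j) (absorbed (lift join) _∨_ (φ-∨ a (J a)) (∨-J a)))
        (lift-absorbed meet p-∧ (i₀-least j) (absorbed (lift meet) _∧_ (φ-∧ a (J a)) (J-∧ a)))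
      where
      absorbed : (_·ₛ_ : Sum → Sum → Sum) (_·_ : Carrier → Carrier → Carrier) →
        φ (a · J a) ≡ φ a ·ₛ φ (J a) → a · J a ≡ a → (j , y) ·ₛ (i₀ , c) ≡ (j , y)
      absorbed _·ₛ_ _·_ φ-· a·Ja≡a = begin
        (j , y) ·ₛ (i₀ , c)   ≡⟨ cong₂ _·ₛ_ φa≡jy φJa≡c ⟨
        φ a ·ₛ φ (J a)        ≡⟨ φ-· ⟨
        φ (a · J a)           ≡⟨ cong φ a·Ja≡a ⟩
        φ a                   ≡⟨ φa≡jy ⟩
        (j , y)               ∎

    p-surjective : ∀ i j (q : i ≤ j) (y : Fib j) → ∃[ x ] p i j q x ≡ y
    p-surjective = p-surjective-from-i₀ λ j y →
      let c , φJa≡c = J-∈-i₀ (ψ (j , y)) in c , J-lifts (φψ (j , y)) φJa≡c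

    J≡top⇒ : ∀ {a} → top i₀ ≢ bot i₀ → φ (J a) ≡ (i₀ , top i₀) →
      IsTopOfNontrivialFibre a × J a ≡ 𝟙
    J≡top⇒ {a} top₀≢bot₀ φJa≡top =
      (j , (top j , bot j , top≢bot) , cong (j ,_) y≡top) , Ja≡𝟙
      where
      j = proj₁ (φ a)
      Ja≡𝟙 : J a ≡ 𝟙
      Ja≡𝟙 = φ-injective (trans φJa≡top (sym φ-1))
      y≡top : proj₂ (φ a) ≡ top j
      y≡top = trans (sym (J-lifts refl φJa≡top)) (p-top i₀ j _)
      top≢bot : top j ≢ bot j
      top≢bot top≡bot = 𝟙≢𝟘 top₀≢bot₀ (begin
        𝟙              ≡⟨ Ja≡𝟙 ⟨
        J a            ≡⟨ cong J (trivial-fibre⇒∧¬-fixed refl top≡bot) ⟨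
        J (a ∧ ¬′ a)   ≡⟨ J-contr a ⟩
        𝟘              ∎)

    J≡bot⇒ : ∀ {a} → φ (J a) ≡ (i₀ , bot i₀) →
      ¬ IsTopOfNontrivialFibre a × J a ≡ 𝟘
    J≡bot⇒ {a} φJa≡bot = not-top , φ-injective (trans φJa≡bot (sym φ-0))
      where
      j = proj₁ (φ a)
      φa≡bot : φ a ≡ (j , bot j)
      φa≡bot = cong (j ,_) (trans (sym (J-lifts refl φJa≡bot)) (p-bot i₀ j _))
      not-top : ¬ IsTopOfNontrivialFibre a
      not-top (i , i∈I⁺ , φa≡top) = InI⁺⇒top≢bot i∈I⁺ (begin
        top i              ≡⟨ p-≡ bot≡top j≤i ⟨
        p j i j≤i (bot j)  ≡⟨ p-bot j i j≤i ⟩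
        bot i              ∎)
        where
        bot≡top = trans (sym φa≡bot) φa≡top
        j≤i = ≤-reflexive (cong proj₁ bot≡top)

    J-dichotomy : TwoElement i₀ → ∀ a →
      (IsTopOfNontrivialFibre a × J a ≡ 𝟙) ⊎ (¬ IsTopOfNontrivialFibre a × J a ≡ 𝟘)
    J-dichotomy two a with J-∈-i₀ a
    ... | c , φJa≡c with TwoElement⇒top⊎bot two c
    ...   | inj₁ c≡top =
      inj₁ (J≡top⇒ (TwoElement⇒top≢bot two) (trans φJa≡c (cong (i₀ ,_) c≡top)))
    ...   | inj₂ c≡bot = inj₂ (J≡bot⇒ (trans φJa≡c (cong (i₀ ,_) c≡bot)))

    IsK⇒IsPrescribedJ : TwoElement i₀ → IsPrescribedJ J
    IsK⇒IsPrescribedJ two a with J-dichotomy two a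
    ... | inj₁ (top , Ja≡𝟙)     = (λ _ → Ja≡𝟙) , (λ not-top → contradiction top not-top)
    ... | inj₂ (not-top , Ja≡𝟘) = (λ top → contradiction top not-top) , (λ _ → Ja≡𝟘)

    IsPrescribedJ⇒IsK : TwoElement i₀ → ∀ {J′} → IsPrescribedJ J′ →
      IsK Carrier _∧_ _∨_ ¬′ J′ 𝟘 𝟙
    IsPrescribedJ⇒IsK two {J′} prescribed = IsK-cong J≗J′ K
      where
      J≗J′ : ∀ a → J a ≡ J′ a
      J≗J′ a with J-dichotomy two a
      ... | inj₁ (top , Ja≡𝟙)     = trans Ja≡𝟙 (sym (proj₁ (prescribed a) top))
      ... | inj₂ (not-top , Ja≡𝟘) = trans Ja≡𝟘 (sym (proj₂ (prescribed a) not-top))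

lemma4p3 : (A : KAlgebra) →
    let open KAlgebra A in
    IsInvolutiveBisemilattice Carrier _∧_ _∨_ ¬′ 𝟘 𝟙
    × ((R : PlonkaRepresentation (reduct A)) →
        let open PlonkaRepresentation R in
        (∀ i j (q : i ≤ j) (y : Fib j) → ∃[ x ] (p i j q x ≡ y))
        × (TwoElement i₀ →
            (∀ (J : Carrier → Carrier) →
              (IsK Carrier _∧_ _∨_ ¬′ J 𝟘 𝟙 → IsPrescribedJ J)
              × (IsPrescribedJ J → IsK Carrier _∧_ _∨_ ¬′ J 𝟘 𝟙))))
lemma4p3 A = IsK.isInvolutiveBisemilattice isK , λ R →
  let open PlonkaRepresentationProperties R in
  p-surjective isK ,
  λ two J → (λ K → IsK⇒IsPrescribedJ K two) , IsPrescribedJ⇒IsK isK two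
  where open KAlgebra A
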